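{- Let $n>k>i$ be non-negative integers such that the generalized Johnson graph $G=J(n,k,i)$ is connected. Then $\mathrm{rc}(G)=\mathrm{rad}(G)-1$.
   Context: The generalized Johnson graph $J(n,k,i)$ has as vertices the $k$-element subsets of an $n$-element set, vertices $A,B$ being adjacent iff $|A\cap B|=i$. Cop and robber game with radius of capture $r$: first the cop chooses a vertex, then the robber; afterwards, starting with the cop, the players alternately either move to an adjacent vertex or stay put, both knowing both positions. The cop wins if at some point the distance between the players is at most $r$. $\mathcal{CWRC}(r)$ is the class of graphs on which the cop has a winning strategy. $\mathrm{rc}(G)=\min\{r\in\mathbb{N}_0 \mid G\in\mathcal{CWRC}(r)\}$. $\mathrm{rad}$ denotes the radius. -}

module Defs where

open import Data.Nat using (ℕ; zero; suc; _≤_; _∸_)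
open import Data.Product using (Σ; ∃; _×_; _,_; proj₁)
open import Data.Sum using (_⊎_)
open import Data.Fin.Subset using (Subset; _∩_; ∣_∣)
open import Relation.Binary.PropositionalEquality using (_≡_)

record Graph : Set₁ where
  field
    V   : Set
    Adj : V → V → Set

module _ (G : Graph) where
  open Graph G

  data Within : ℕ → V → V → Set where
    here : ∀ {d u} → Within d u u
    step : ∀ {d u w v} → Adj u w → Within d w v → Within (suc d) u v

  Connected : Set
  Connected = ∀ u v → ∃ λ d → Within d u v

  EccAtMost : ℕ → V → Set
  EccAtMost e u = ∀ v → Within e u v

  IsRadius : ℕ → Set
  IsRadius ρ = (∃ λ u → EccAtMost ρ u) × (∀ m → (∃ λ u → EccAtMost m u) → ρ ≤ m)

  Move : V → V → Set
  Move x y = (x ≡ y) ⊎ Adj x y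

  -- CopWinFrom r c x : in the game with radius of capture r, with the cop at c and
  -- the robber at x and the cop to move, the cop can force capture (distance ≤ r)
  -- in finitely many rounds.  Capture is checked at every position.
  data CopWinFrom (r : ℕ) (c x : V) : Set where
    caught : Within r c x → CopWinFrom r c x
    play   : (c' : V) → Move c c' →
             (Within r c' x ⊎ (∀ x' → Move x x' → CopWinFrom r c' x')) →
             CopWinFrom r c x

  -- G ∈ CWRC(r): the cop chooses a start vertex, then the robber (knowing it) chooses his,
  -- and the cop (moving first) wins.
  CWRC : ℕ → Set
  CWRC r = ∃ λ c → ∀ x → CopWinFrom r c x

  IsRc : ℕ → Set
  IsRc r = CWRC r × (∀ r' → CWRC r' → r ≤ r')

J : ℕ → ℕ → ℕ → Graph
J n k i = record
  { V   = Σ (Subset n) (λ A → ∣ A ∣ ≡ k)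
  ; Adj = λ A B → ∣ proj₁ A ∩ proj₁ B ∣ ≡ i
  }

{-# OPTIONS --safe #-}
module Submission where

-- If u is a centre, a cop starting at u steps towards the robber and is then within
-- rad − 1 of him. Conversely, any two vertices of J(n,k,i) are exchanged by an
-- involutive automorphism σ, induced by an involution of the ground set exchanging the
-- two k-sets. A robber at x with d(c, x) ≥ r + 2 answers the cop's move c → c′ with
-- σ c, where σ exchanges c′ and x: then σ c is adjacent (or equal) to σ c′ = x and
-- d(c′, σ c) = d(x, c), so the cop never catches him at radius r. Hence the cop's
-- starting vertex has eccentricity ≤ r + 1, i.e. rad ≤ rc + 1.

open import Algebra.Definitions using (Involutive)
open import Data.Bool.Base using (Bool; true; false; _∧_)
open import Data.Bool.Properties using () renaming (_≟_ to _≟ᵇ_)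
open import Data.Fin.Base using (Fin; zero; suc)
open import Data.Fin.Permutation using (permutation)
open import Data.Fin.Properties using () renaming (_≟_ to _≟ᶠ_)
open import Data.Fin.Subset using (Subset; _∩_; ∣_∣; inside; outside)
open import Data.Fin.Subset.Properties using (∩-comm; anySubset?)
open import Data.Nat.Base using (ℕ; zero; suc; _≤_; _<_; _∸_; s≤s)
open import Data.Nat.Properties
  using (+-0-commutativeMonoid; _≟_; ≡-irrelevant; suc-injective; ≤-reflexive; n≤1+n; <⇒≤; ∸-monoˡ-≤)
open import Data.Product.Base using (Σ; ∃; _×_; _,_; proj₁)
open import Data.Product.Properties using () renaming (≡-dec to Σ-≡-dec)
open import Data.Sum.Base using (_⊎_; inj₁; inj₂)
open import Data.Vec.Base using (_∷_; []; lookup; tabulate; _[_]≔_)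
open import Data.Vec.Properties
  using (lookup∘tabulate; tabulate∘lookup; tabulate-cong; lookup-zipWith; lookup∘update; lookup∘update′)
  renaming (≡-dec to Vec-≡-dec)
open import Defs
open import Function.Base using (_∘_)
open import Level using (0ℓ)
open import Relation.Binary.Definitions using (Decidable; DecidableEquality)
open import Relation.Binary.PropositionalEquality
  using (_≡_; _≢_; refl; sym; trans; cong; cong₂; subst; subst₂; module ≡-Reasoning)
open import Relation.Nullary.Decidable using (Dec; yes; no; map′; decidable-stable; _⊎-dec_; _×-dec_)
open import Relation.Nullary.Negation using (¬_; contradiction)
import Relation.Unary as U
open import Algebra.Properties.CommutativeMonoid.Sum +-0-commutativeMonoid using (sum; sum-permute; sum-cong-≗)

module _ (G : Graph) where
  open Graph G

  Within-weaken : ∀ {d d′ u v} → d ≤ d′ → Within G d u v → Within G d′ u v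
  Within-weaken _         here       = here
  Within-weaken (s≤s d≤d′) (step a w) = step a (Within-weaken d≤d′ w)

  Within-move : ∀ {d c c′ x} → Move G c c′ → Within G d c′ x → Within G (suc d) c x
  Within-move (inj₁ refl) w = Within-weaken (n≤1+n _) w
  Within-move (inj₂ a)    w = step a w

  Within-snoc : ∀ {d u w v} → Within G d u w → Adj w v → Within G (suc d) u v
  Within-snoc here       a = step a here
  Within-snoc (step b w) a = step b (Within-snoc w a)

  Within-map : {σ : V → V} → (∀ {a b} → Adj a b → Adj (σ a) (σ b)) →
               ∀ {d u v} → Within G d u v → Within G d (σ u) (σ v)
  Within-map _     here       = here
  Within-map σ-adj (step a w) = step (σ-adj a) (Within-map σ-adj w)

  Move-map : {σ : V → V} → (∀ {a b} → Adj a b → Adj (σ a) (σ b)) →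
             ∀ {u v} → Move G u v → Move G (σ u) (σ v)
  Move-map _     (inj₁ refl) = inj₁ refl
  Move-map σ-adj (inj₂ a)    = inj₂ (σ-adj a)

  record Swap (u v : V) : Set where
    field
      σ            : V → V
      σ-involutive : Involutive _≡_ σ
      σ-adj        : ∀ {a b} → Adj a b → Adj (σ a) (σ b)
      σ-swaps      : σ u ≡ v

  cop-wins-from-centre : ∀ {ρ u} → EccAtMost G ρ u → CWRC G (ρ ∸ 1)
  cop-wins-from-centre {u = u} ecc = u , λ x → approach (ecc x)
    where
    approach : ∀ {d x} → Within G d u x → CopWinFrom G (d ∸ 1) u x
    approach here       = caught here
    approach (step a w) = play _ (inj₂ a) (inj₁ w)

  module _ (_≟ⱽ_ : DecidableEquality V) (adj? : Decidable Adj)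
           (any? : ∀ {P : U.Pred V 0ℓ} → U.Decidable P → Dec (∃ P)) where

    within? : ∀ d u v → Dec (Within G d u v)
    within? zero    u v = map′ (λ { refl → here }) (λ { here → refl }) (u ≟ⱽ v)
    within? (suc d) u v = map′ from to (u ≟ⱽ v ⊎-dec any? (λ w → adj? u w ×-dec within? d w v))
      where
      from : u ≡ v ⊎ ∃ (λ w → Adj u w × Within G d w v) → Within G (suc d) u v
      from (inj₁ refl)         = here
      from (inj₂ (_ , a , w)) = step a w
      to : Within G (suc d) u v → u ≡ v ⊎ ∃ (λ w → Adj u w × Within G d w v)
      to here       = inj₁ refl
      to (step a w) = inj₂ (_ , a , w)

  module _ (adj-sym : ∀ {u v} → Adj u v → Adj v u) (swap : ∀ u v → Swap u v) where

    Within-sym : ∀ {d u v} → Within G d u v → Within G d v u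
    Within-sym here       = here
    Within-sym (step a w) = Within-snoc (Within-sym w) (adj-sym a)

    Move-sym : ∀ {u v} → Move G u v → Move G v u
    Move-sym (inj₁ refl) = inj₁ refl
    Move-sym (inj₂ a)    = inj₂ (adj-sym a)

    robber-escapes : ∀ {r c x} → ¬ Within G (suc r) c x → ¬ CopWinFrom G r c x
    robber-escapes far (caught near)               = far (Within-weaken (n≤1+n _) near)
    robber-escapes far (play c′ c→c′ (inj₁ near)) = far (Within-move c→c′ near)
    robber-escapes {r} {c} {x} far (play c′ c→c′ (inj₂ continue)) =
      robber-escapes far′ (continue (σ c) x→σc)
      where
      open Swap (swap c′ x)
      x→σc : Move G x (σ c)
      x→σc = Move-sym (subst (Move G (σ c)) σ-swaps (Move-map σ-adj c→c′))
      far′ : ¬ Within G (suc r) c′ (σ c)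
      far′ near = far (Within-sym (subst₂ (Within G (suc r)) σ-swaps (σ-involutive c) (Within-map σ-adj near)))

    cop-start-eccentricity : (∀ d u v → Dec (Within G d u v)) →
                             ∀ {r} → CWRC G r → ∃ (EccAtMost G (suc r))
    cop-start-eccentricity within-dec (c , win) =
      c , λ x → decidable-stable (within-dec _ c x) (λ far → robber-escapes far (win x))

    rc≡rad∸1 : (∀ d u v → Dec (Within G d u v)) → ∀ ρ → IsRadius G ρ → IsRc G (ρ ∸ 1)
    rc≡rad∸1 within-dec ρ ((_ , ecc) , minimal) =
      cop-wins-from-centre ecc ,
      λ r win → ∸-monoˡ-≤ 1 (minimal (suc r) (cop-start-eccentricity within-dec win))

record _⇄_ {n} (A B : Subset n) : Set where
  field
    π                 : Fin n → Fin n
    π-involutive      : Involutive _≡_ π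
    π-exchanges       : ∀ j → lookup A (π j) ≡ lookup B j
    π-fixes-agreement : ∀ j → lookup A j ≡ lookup B j → π j ≡ j

  π-exchanges˘ : ∀ j → lookup B (π j) ≡ lookup A j
  π-exchanges˘ j = trans (sym (π-exchanges (π j))) (cong (lookup A) (π-involutive j))

⇄-sym : ∀ {n} {A B : Subset n} → A ⇄ B → B ⇄ A
⇄-sym E = record
  { π                 = π
  ; π-involutive      = π-involutive
  ; π-exchanges       = π-exchanges˘
  ; π-fixes-agreement = λ j e → π-fixes-agreement j (sym e)
  }
  where open _⇄_ E

⇄-[] : [] ⇄ []
⇄-[] = record { π = λ () ; π-involutive = λ () ; π-exchanges = λ () ; π-fixes-agreement = λ () }

⇄-∷ : ∀ {n} {A B : Subset n} x → A ⇄ B → (x ∷ A) ⇄ (x ∷ B)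
⇄-∷ {n} {A} {B} x E = record
  { π = π′ ; π-involutive = π′-involutive ; π-exchanges = π′-exchanges ; π-fixes-agreement = π′-fixes }
  where
  open _⇄_ E
  π′ : Fin (suc n) → Fin (suc n)
  π′ zero    = zero
  π′ (suc j) = suc (π j)
  π′-involutive : Involutive _≡_ π′
  π′-involutive zero    = refl
  π′-involutive (suc j) = cong suc (π-involutive j)
  π′-exchanges : ∀ j → lookup (x ∷ A) (π′ j) ≡ lookup (x ∷ B) j
  π′-exchanges zero    = refl
  π′-exchanges (suc j) = π-exchanges j
  π′-fixes : ∀ j → lookup (x ∷ A) j ≡ lookup (x ∷ B) j → π′ j ≡ j
  π′-fixes zero    _ = refl
  π′-fixes (suc j) e = cong suc (π-fixes-agreement j e)

-- π fixes q since A and B [ q ]≔ outside agree at q, so swapping 0 with suc q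
-- commutes with π and keeps it an involution.
⇄-∷-mismatch : ∀ {n} {A B : Subset n} {q} → lookup A q ≡ outside → lookup B q ≡ inside →
               A ⇄ (B [ q ]≔ outside) → (inside ∷ A) ⇄ (outside ∷ B)
⇄-∷-mismatch {n} {A} {B} {q} Aq Bq E = record
  { π = π′ ; π-involutive = π′-involutive ; π-exchanges = π′-exchanges ; π-fixes-agreement = π′-fixes }
  where
  open _⇄_ E
  B-elsewhere : ∀ {j} → j ≢ q → lookup (B [ q ]≔ outside) j ≡ lookup B j
  B-elsewhere j≢q = lookup∘update′ j≢q B outside
  πq≡q : π q ≡ q
  πq≡q = π-fixes-agreement q (trans Aq (sym (lookup∘update q B outside)))
  π-avoids-q : ∀ {j} → j ≢ q → π j ≢ q
  π-avoids-q {j} j≢q πj≡q = j≢q (trans (sym (π-involutive j)) (trans (cong π πj≡q) πq≡q))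
  π′ : Fin (suc n) → Fin (suc n)
  π′ zero = suc q
  π′ (suc j) with j ≟ᶠ q
  ... | yes _ = zero
  ... | no  _ = suc (π j)
  π′-involutive : Involutive _≡_ π′
  π′-involutive zero with q ≟ᶠ q
  ... | yes _   = refl
  ... | no  q≢q = contradiction refl q≢q
  π′-involutive (suc j) with j ≟ᶠ q
  ... | yes refl = refl
  ... | no  j≢q with π j ≟ᶠ q
  ...   | yes πj≡q = contradiction πj≡q (π-avoids-q j≢q)
  ...   | no  _    = cong suc (π-involutive j)
  π′-exchanges : ∀ j → lookup (inside ∷ A) (π′ j) ≡ lookup (outside ∷ B) j
  π′-exchanges zero = Aq
  π′-exchanges (suc j) with j ≟ᶠ q
  ... | yes refl = sym Bq
  ... | no  j≢q  = trans (π-exchanges j) (B-elsewhere j≢q)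
  π′-fixes : ∀ j → lookup (inside ∷ A) j ≡ lookup (outside ∷ B) j → π′ j ≡ j
  π′-fixes zero ()
  π′-fixes (suc j) e with j ≟ᶠ q
  ... | yes refl = contradiction (trans (sym Aq) (trans e Bq)) λ ()
  ... | no  j≢q  = cong suc (π-fixes-agreement j (trans e (sym (B-elsewhere j≢q))))

∣p∣<∣q∣⇒q⊈p : ∀ {n} {p q : Subset n} → ∣ p ∣ < ∣ q ∣ → ∃ λ x → lookup p x ≡ outside × lookup q x ≡ inside
∣p∣<∣q∣⇒q⊈p {p = outside ∷ p} {inside  ∷ q} _ = zero , refl , refl
∣p∣<∣q∣⇒q⊈p {p = inside  ∷ p} {inside  ∷ q} (s≤s lt) with ∣p∣<∣q∣⇒q⊈p {p = p} {q} lt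
... | x , px , qx = suc x , px , qx
∣p∣<∣q∣⇒q⊈p {p = outside ∷ p} {outside ∷ q} lt with ∣p∣<∣q∣⇒q⊈p {p = p} {q} lt
... | x , px , qx = suc x , px , qx
∣p∣<∣q∣⇒q⊈p {p = inside  ∷ p} {outside ∷ q} lt with ∣p∣<∣q∣⇒q⊈p {p = p} {q} (<⇒≤ lt)
... | x , px , qx = suc x , px , qx

suc∣p[x]≔outside∣≡∣p∣ : ∀ {n} (p : Subset n) {x} → lookup p x ≡ inside → suc ∣ p [ x ]≔ outside ∣ ≡ ∣ p ∣
suc∣p[x]≔outside∣≡∣p∣ (inside  ∷ p) {zero}  _  = refl
suc∣p[x]≔outside∣≡∣p∣ (inside  ∷ p) {suc x} px = cong suc (suc∣p[x]≔outside∣≡∣p∣ p px)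
suc∣p[x]≔outside∣≡∣p∣ (outside ∷ p) {suc x} px = suc∣p[x]≔outside∣≡∣p∣ p px

⇄-of-equal-size : ∀ {n} (A B : Subset n) → ∣ A ∣ ≡ ∣ B ∣ → A ⇄ B
inside∷⇄outside∷ : ∀ {n} (A B : Subset n) → suc ∣ A ∣ ≡ ∣ B ∣ → (inside ∷ A) ⇄ (outside ∷ B)

⇄-of-equal-size []            []            _ = ⇄-[]
⇄-of-equal-size (inside  ∷ A) (inside  ∷ B) e = ⇄-∷ inside (⇄-of-equal-size A B (suc-injective e))
⇄-of-equal-size (outside ∷ A) (outside ∷ B) e = ⇄-∷ outside (⇄-of-equal-size A B e)
⇄-of-equal-size (inside  ∷ A) (outside ∷ B) e = inside∷⇄outside∷ A B e
⇄-of-equal-size (outside ∷ A) (inside  ∷ B) e = ⇄-sym (inside∷⇄outside∷ B A (sym e))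

inside∷⇄outside∷ A B e with ∣p∣<∣q∣⇒q⊈p {p = A} {B} (≤-reflexive e)
... | q , Aq , Bq = ⇄-∷-mismatch Aq Bq
  (⇄-of-equal-size A (B [ q ]≔ outside) (suc-injective (trans e (sym (suc∣p[x]≔outside∣≡∣p∣ B Bq)))))

preimage : ∀ {n} → (Fin n → Fin n) → Subset n → Subset n
preimage π A = tabulate (lookup A ∘ π)

lookup-preimage : ∀ {n} (π : Fin n → Fin n) (A : Subset n) j → lookup (preimage π A) j ≡ lookup A (π j)
lookup-preimage π A = lookup∘tabulate (lookup A ∘ π)

preimage-∩ : ∀ {n} (π : Fin n → Fin n) (A B : Subset n) → preimage π A ∩ preimage π B ≡ preimage π (A ∩ B)
preimage-∩ π A B = begin
  preimage π A ∩ preimage π B                               ≡⟨ tabulate∘lookup _ ⟨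
  tabulate (lookup (preimage π A ∩ preimage π B))           ≡⟨ tabulate-cong lookup-∩ ⟩
  preimage π (A ∩ B)                                        ∎
  where
  open ≡-Reasoning
  lookup-∩ : ∀ j → lookup (preimage π A ∩ preimage π B) j ≡ lookup (A ∩ B) (π j)
  lookup-∩ j = begin
    lookup (preimage π A ∩ preimage π B) j               ≡⟨ lookup-zipWith _∧_ j (preimage π A) (preimage π B) ⟩
    lookup (preimage π A) j ∧ lookup (preimage π B) j   ≡⟨ cong₂ _∧_ (lookup-preimage π A j) (lookup-preimage π B j) ⟩
    lookup A (π j) ∧ lookup B (π j)                       ≡⟨ lookup-zipWith _∧_ (π j) A B ⟨
    lookup (A ∩ B) (π j)                                  ∎

bit : Bool → ℕ
bit true  = 1
bit false = 0

∣p∣≡sum : ∀ {n} (p : Subset n) → ∣ p ∣ ≡ sum (bit ∘ lookup p)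
∣p∣≡sum []            = refl
∣p∣≡sum (inside  ∷ p) = cong suc (∣p∣≡sum p)
∣p∣≡sum (outside ∷ p) = ∣p∣≡sum p

∣preimage∣ : ∀ {n} {π : Fin n → Fin n} → Involutive _≡_ π → ∀ p → ∣ preimage π p ∣ ≡ ∣ p ∣
∣preimage∣ {π = π} π-involutive p = begin
  ∣ preimage π p ∣                     ≡⟨ ∣p∣≡sum (preimage π p) ⟩
  sum (bit ∘ lookup (preimage π p))    ≡⟨ sum-cong-≗ (cong bit ∘ lookup-preimage π p) ⟩
  sum (bit ∘ lookup p ∘ π)             ≡⟨ sum-permute (bit ∘ lookup p) (permutation π π π-involutive π-involutive) ⟨
  sum (bit ∘ lookup p)                 ≡⟨ ∣p∣≡sum p ⟨
  ∣ p ∣                                ∎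
  where open ≡-Reasoning

∣preimage-∩∣ : ∀ {n} {π : Fin n → Fin n} → Involutive _≡_ π →
               ∀ A B → ∣ preimage π A ∩ preimage π B ∣ ≡ ∣ A ∩ B ∣
∣preimage-∩∣ {π = π} π-involutive A B =
  trans (cong ∣_∣ (preimage-∩ π A B)) (∣preimage∣ π-involutive (A ∩ B))

preimage-involutive : ∀ {n} {π : Fin n → Fin n} → Involutive _≡_ π → ∀ A → preimage π (preimage π A) ≡ A
preimage-involutive {π = π} π-involutive A = trans
  (tabulate-cong (λ j → trans (lookup-preimage π A (π j)) (cong (lookup A) (π-involutive j))))
  (tabulate∘lookup A)

preimage-⇄ : ∀ {n} {A B : Subset n} (E : A ⇄ B) → preimage (_⇄_.π E) A ≡ B
preimage-⇄ {B = B} E = trans (tabulate-cong (_⇄_.π-exchanges E)) (tabulate∘lookup B)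

module _ (n k i : ℕ) where
  open Graph (J n k i)

  J-vertex-≡ : {u v : V} → proj₁ u ≡ proj₁ v → u ≡ v
  J-vertex-≡ {_ , p} {_ , q} refl = cong (_ ,_) (≡-irrelevant p q)

  J-adj-sym : ∀ {u v} → Adj u v → Adj v u
  J-adj-sym {A , _} {B , _} = trans (cong ∣_∣ (∩-comm B A))

  J-swap : ∀ u v → Swap (J n k i) u v
  J-swap (A , ∣A∣≡k) (B , ∣B∣≡k) = record
    { σ            = σ
    ; σ-involutive = λ u → J-vertex-≡ (preimage-involutive π-involutive (proj₁ u))
    ; σ-adj        = λ {(C , _)} {(D , _)} → trans (∣preimage-∩∣ π-involutive C D)
    ; σ-swaps      = J-vertex-≡ (preimage-⇄ E)
    }
    where
    E : A ⇄ B
    E = ⇄-of-equal-size A B (trans ∣A∣≡k (sym ∣B∣≡k))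
    open _⇄_ E
    σ : V → V
    σ (C , ∣C∣≡k) = preimage π C , trans (∣preimage∣ π-involutive C) ∣C∣≡k

  J-≟ : DecidableEquality V
  J-≟ = Σ-≡-dec (Vec-≡-dec _≟ᵇ_) (λ p q → yes (≡-irrelevant p q))

  J-adj? : Decidable Adj
  J-adj? (A , _) (B , _) = ∣ A ∩ B ∣ ≟ i

  J-any? : ∀ {P : U.Pred V 0ℓ} → U.Decidable P → Dec (∃ P)
  J-any? {P} P? = map′ (λ { (A , p , x) → (A , p) , x }) (λ { ((A , p) , x) → A , p , x }) (anySubset? vertex?)
    where
    vertex? : ∀ A → Dec (Σ (∣ A ∣ ≡ k) λ p → P (A , p))
    vertex? A with ∣ A ∣ ≟ k
    ... | no  ∣A∣≢k = no (∣A∣≢k ∘ proj₁)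
    ... | yes p     = map′ (p ,_) (λ { (p′ , x) → subst (λ p → P (A , p)) (≡-irrelevant p′ p) x }) (P? (A , p))

theorem4p6 : (n k i : ℕ) → i < k → k < n → Connected (J n k i) →
    ∀ ρ → IsRadius (J n k i) ρ → IsRc (J n k i) (ρ ∸ 1)
theorem4p6 n k i _ _ _ = rc≡rad∸1 (J n k i) (λ {u} {v} → J-adj-sym n k i {u} {v}) (J-swap n k i)
  (within? (J n k i) (J-≟ n k i) (J-adj? n k i) (J-any? n k i))
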